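{- Let $n\ge 2$, let $A=[a_{kl}]$ be a real $n\times n$ matrix with zero diagonal and $f(\sigma)=\sum_{p=1}^{n-1}\sum_{q=p+1}^{n} a_{\sigma(p)\sigma(q)}$ on $\Sigma_n$. For $i\in\{1,\dots,n-1\}$ and $j\in\{1,\dots,n\}$ let $\mu_{ij}=\frac{1}{(n-1)!}\sum_{\sigma:\sigma(i)=j}f(\sigma)$ and $\mu_{i+1\,j}=\frac{1}{(n-1)!}\sum_{\sigma:\sigma(i+1)=j}f(\sigma)$. Then $$\mu_{i+1\,j}-\mu_{ij}=\frac{1}{n-1}\sum_{k\ne j}(a_{kj}-a_{jk}).$$
   Context: $\Sigma_n$ is the set of permutations of $\{1,\dots,n\}$; $\sigma(p)$ is the row/column index of $A$ placed in position $p$. -}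

module Defs where

open import Level using (Level)
open import Data.Nat using (ℕ; zero; suc; _∸_)
open import Data.Fin using (Fin; _≟_; _<?_)
open import Data.Vec using (Vec; []; _∷_; lookup)
open import Data.Vec.Relation.Unary.Unique.Propositional using (Unique)
open import Data.Vec.Relation.Unary.AllPairs using (allPairs?)
open import Data.List using (List; []; _∷_; map; concatMap; filter; allFin; foldr)
open import Relation.Nullary using (¬?)
open import Algebra.Bundles using (CommutativeRing)

allVecs : (n k : ℕ) → List (Vec (Fin k) n)
allVecs zero    k = [] ∷ []
allVecs (suc n) k = concatMap (λ x → map (x ∷_) (allVecs n k)) (allFin k)

-- Σ_n : permutations of Fin n, represented as Vec (Fin n) n with pairwise
-- distinct entries; σ(p) = lookup σ p.  Each permutation occurs exactly once.
Perms : (n : ℕ) → List (Vec (Fin n) n)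
Perms n = filter (allPairs? (λ x y → ¬? (x ≟ y))) (allVecs n n)

module WithRing {c ℓ : Level} (R : CommutativeRing c ℓ) where
  open CommutativeRing R

  sumL : List Carrier → Carrier
  sumL = foldr _+_ 0#

  fromℕ : ℕ → Carrier
  fromℕ zero    = 0#
  fromℕ (suc m) = 1# + fromℕ m

  f : {n : ℕ} → (Fin n → Fin n → Carrier) → Vec (Fin n) n → Carrier
  f {n} a σ = sumL (concatMap (λ p → map (λ q → a (lookup σ p) (lookup σ q))
                                         (filter (p <?_) (allFin n)))
                              (allFin n))

  -- S i j = Σ_{σ : σ(i) = j} f(σ)   (so μ_{ij} = S i j / (n-1)!)
  S : {n : ℕ} → (Fin n → Fin n → Carrier) → Fin n → Fin n → Carrier
  S {n} a i j = sumL (map (f a) (filter (λ σ → lookup σ i ≟ j) (Perms n)))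

  D : {n : ℕ} → (Fin n → Fin n → Carrier) → Fin n → Carrier
  D {n} a j = sumL (map (λ k → a k j - a j k)
                        (filter (λ k → ¬? (k ≟ j)) (allFin n)))

{-# OPTIONS --safe #-}
-- Transposing the entries in positions i and i + 1 maps the permutations with σ(i) = j
-- bijectively onto those with σ(i+1) = j, and changes f(σ) by a_{kj} − a_{jk}, where
-- k = σ(i+1). Hence S_{i+1,j} − S_{ij} = Σ_k N_k (a_{kj} − a_{jk}), where N_k counts the
-- permutations with σ(i) = j and σ(i+1) = k. The term k = j vanishes; for k ≠ j, deleting
-- the values j, k from their positions and relabelling identifies these permutations with
-- Σ_{n−2}, so N_k = (n−2)!, and (n−1)·(n−2)! = (n−1)!.

module Submission where

open import Defs
open import Level using (Level)
open import Function using (_∘_; mk⇔)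
open import Data.Bool using (true; false)
open import Data.Product using (_×_; _,_; proj₂; ∃-syntax)
open import Data.Nat as ℕ using (ℕ; zero; suc; _≤_; _<_; _∸_; _!; z≤n; s≤s)
import Data.Nat.Properties as ℕ
open import Data.Nat.ListAction using (sum)
open import Data.Fin as Fin using (Fin; toℕ; fromℕ<; _≟_; punchIn; punchOut)
import Data.Fin.Properties as Fin
open import Data.Vec as Vec using (Vec; []; _∷_; lookup; insertAt; removeAt; tabulate)
import Data.Vec.Properties as Vec
import Data.Vec.Relation.Unary.All as VAll
import Data.Vec.Relation.Unary.All.Properties as VAll
open import Data.Vec.Relation.Unary.AllPairs using (_∷_)
open import Data.Vec.Relation.Unary.Unique.Propositional as VUnique using ()
import Data.Vec.Relation.Unary.Unique.Propositional.Properties as VUnique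
open import Data.List as List using (List; []; _∷_; map; filter; allFin; length)
import Data.List.Properties as List
import Data.List.Relation.Unary.All as LAll
import Data.List.Relation.Unary.All.Properties as LAll
import Data.List.Relation.Unary.AllPairs as LAllPairs
open import Data.List.Membership.Propositional using (_∈_; lose)
open import Data.List.Membership.Propositional.Properties
  using (∈-allFin; ∈-map⁺; ∈-map⁻; ∈-concatMap⁺; ∈-filter⁺; ∈-filter⁻)
open import Data.List.Membership.Propositional.Properties.WithK using (unique∧set⇒bag)
open import Data.List.Relation.Unary.Any using (here)
open import Data.List.Relation.Unary.Unique.Propositional as LUnique using ()
import Data.List.Relation.Unary.Unique.Propositional.Properties as LUnique
open import Data.List.Relation.Binary.BagAndSetEquality using (∼bag⇒↭)
open import Data.List.Relation.Binary.Permutation.Propositional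
  using (_↭_; ↭-refl; ↭-prep; ↭-swap; ↭⇒↭ₛ′; module PermutationReasoning)
open import Data.List.Relation.Binary.Permutation.Propositional.Properties
  using (filter-↭; ↭-length) renaming (map⁺ to ↭-map⁺)
open import Relation.Binary.PropositionalEquality
  using (_≡_; refl; sym; trans; cong; cong₂; subst; module ≡-Reasoning)
open import Relation.Nullary using (¬_; ¬?; does; yes; no)
open import Relation.Nullary.Decidable using (decidable-stable)
open import Relation.Unary using (Pred; Decidable)
open import Algebra.Bundles using (CommutativeMonoid; CommutativeRing)
import Algebra.Properties.CommutativeSemigroup as CommutativeSemigroupProperties
import Algebra.Properties.AbelianGroup as AbelianGroupProperties
import Algebra.Properties.Semiring.Mult as SemiringMult
import Relation.Binary.Reasoning.Setoid as ≈-Reasoning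
import Data.List.Relation.Binary.Permutation.Setoid.Properties as PermutationSetoid

private
  variable
    a b : Level
    A : Set a
    B : Set b
    m n : ℕ

filter-map : ∀ {p} {P : Pred B p} (P? : Decidable P) (f : A → B) (xs : List A) →
             filter P? (map f xs) ≡ map f (filter (P? ∘ f) xs)
filter-map P? f []       = refl
filter-map P? f (x ∷ xs) with does (P? (f x))
... | true  = cong (f x ∷_) (filter-map P? f xs)
... | false = filter-map P? f xs

length-filter-map : ∀ {p} {P : Pred B p} (P? : Decidable P) (f : A → B) (xs : List A) →
                    length (filter P? (map f xs)) ≡ length (filter (P? ∘ f) xs)
length-filter-map P? f xs =
  trans (cong length (filter-map P? f xs)) (List.length-map f (filter (P? ∘ f) xs))

unique∧set⇒↭ : {xs ys : List A} → LUnique.Unique xs → LUnique.Unique ys →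
               (∀ {x} → x ∈ xs → x ∈ ys) → (∀ {x} → x ∈ ys → x ∈ xs) → xs ↭ ys
unique∧set⇒↭ ux uy to from = ∼bag⇒↭ (unique∧set⇒bag ux uy (mk⇔ to from))

lookup-removeAt : (xs : Vec A (suc n)) (i : Fin (suc n)) (j : Fin n) →
                  lookup (removeAt xs i) j ≡ lookup xs (punchIn i j)
lookup-removeAt xs i j = begin
  lookup (removeAt xs i) j
    ≡⟨ Vec.insertAt-punchIn (removeAt xs i) i (lookup xs i) j ⟨
  lookup (insertAt (removeAt xs i) i (lookup xs i)) (punchIn i j)
    ≡⟨ cong (λ ys → lookup ys (punchIn i j)) (Vec.insertAt-removeAt xs i) ⟩
  lookup xs (punchIn i j) ∎
  where open ≡-Reasoning

lookup-extensionality : {xs ys : Vec A n} → (∀ i → lookup xs i ≡ lookup ys i) → xs ≡ ys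
lookup-extensionality {xs = xs} {ys} eq =
  trans (sym (Vec.tabulate∘lookup xs)) (trans (Vec.tabulate-cong eq) (Vec.tabulate∘lookup ys))

All-insertAt⁺ : ∀ {p} {P : Pred A p} {xs : Vec A n} {v} (i : Fin (suc n)) →
                VAll.All P xs → P v → VAll.All P (insertAt xs i v)
All-insertAt⁺ Fin.zero    pxs               pv = pv VAll.∷ pxs
All-insertAt⁺ (Fin.suc i) (px VAll.∷ pxs) pv = px VAll.∷ All-insertAt⁺ i pxs pv

Unique-insertAt⁺ : {xs : Vec A n} {v : A} (i : Fin (suc n)) →
                   VUnique.Unique xs → VAll.All (λ x → ¬ v ≡ x) xs → VUnique.Unique (insertAt xs i v)
Unique-insertAt⁺ Fin.zero    uxs                v∉xs = v∉xs ∷ uxs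
Unique-insertAt⁺ (Fin.suc i) (x∉xs ∷ uxs) (v≢x VAll.∷ v∉xs) =
  All-insertAt⁺ i x∉xs (v≢x ∘ sym) ∷ Unique-insertAt⁺ i uxs v∉xs

-- Enumerating permutations

concatMap-map≡cartesianProductWith : ∀ {C : Set} (f : A → B → C) xs ys →
  List.concatMap (λ x → map (f x) ys) xs ≡ List.cartesianProductWith f xs ys
concatMap-map≡cartesianProductWith f []       ys = refl
concatMap-map≡cartesianProductWith f (x ∷ xs) ys =
  cong (map (f x) ys List.++_) (concatMap-map≡cartesianProductWith f xs ys)

allVecs-unique : ∀ n k → LUnique.Unique (allVecs n k)
allVecs-unique zero    k = LAll.[] LAllPairs.∷ LAllPairs.[]
allVecs-unique (suc n) k =
  subst LUnique.Unique (sym (concatMap-map≡cartesianProductWith _∷_ (allFin k) (allVecs n k)))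
    (LUnique.cartesianProductWith⁺ _∷_ Vec.∷-injective (LUnique.allFin⁺ k) (allVecs-unique n k))

∈-allVecs : ∀ n k (v : Vec (Fin k) n) → v ∈ allVecs n k
∈-allVecs zero    k []       = here refl
∈-allVecs (suc n) k (x ∷ v) =
  ∈-concatMap⁺ (λ x → map (x ∷_) (allVecs n k))
    (lose (∈-allFin x) (∈-map⁺ (x ∷_) (∈-allVecs n k v)))

Perms-unique : ∀ n → LUnique.Unique (Perms n)
Perms-unique n = LUnique.filter⁺ _ (allVecs-unique n n)

∈-Perms⁺ : {σ : Vec (Fin n) n} → VUnique.Unique σ → σ ∈ Perms n
∈-Perms⁺ {n} {σ} u = ∈-filter⁺ _ (∈-allVecs n n σ) u

∈-Perms⁻ : {σ : Vec (Fin n) n} → σ ∈ Perms n → VUnique.Unique σ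
∈-Perms⁻ {n} σ∈ = proj₂ (∈-filter⁻ _ {xs = allVecs n n} σ∈)

-- Fixing the value at one position

-- The permutation with value j at position p which induces w on the remaining positions and values.
insertValueAt : Fin (suc m) → Fin (suc m) → Vec (Fin m) m → Vec (Fin (suc m)) (suc m)
insertValueAt p j w = insertAt (Vec.map (punchIn j) w) p j

lookup-insertValueAt : (p j : Fin (suc m)) (w : Vec (Fin m) m) (q : Fin m) →
                       lookup (insertValueAt p j w) (punchIn p q) ≡ punchIn j (lookup w q)
lookup-insertValueAt p j w q =
  trans (Vec.insertAt-punchIn (Vec.map (punchIn j) w) p j q) (Vec.lookup-map q (punchIn j) w)

insertValueAt-injective : (p j : Fin (suc m)) {w w′ : Vec (Fin m) m} →
                          insertValueAt p j w ≡ insertValueAt p j w′ → w ≡ w′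
insertValueAt-injective p j {w} {w′} eq = lookup-extensionality λ q →
  Fin.punchIn-injective j _ _ (begin
    punchIn j (lookup w q)                      ≡⟨ lookup-insertValueAt p j w q ⟨
    lookup (insertValueAt p j w) (punchIn p q)  ≡⟨ cong (λ σ → lookup σ (punchIn p q)) eq ⟩
    lookup (insertValueAt p j w′) (punchIn p q) ≡⟨ lookup-insertValueAt p j w′ q ⟩
    punchIn j (lookup w′ q)                     ∎)
  where open ≡-Reasoning

insertValueAt-unique : (p j : Fin (suc m)) {w : Vec (Fin m) m} →
                       VUnique.Unique w → VUnique.Unique (insertValueAt p j w)
insertValueAt-unique p j {w} uw = Unique-insertAt⁺ p
  (VUnique.map⁺ (Fin.punchIn-injective j _ _) uw)
  (VAll.map⁺ (VAll.universal (λ x → Fin.punchInᵢ≢i j x ∘ sym) w))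

insertValueAt-surjective : (p : Fin (suc m)) {σ : Vec (Fin (suc m)) (suc m)} → VUnique.Unique σ →
                           ∃[ w ] VUnique.Unique w × insertValueAt p (lookup σ p) w ≡ σ
insertValueAt-surjective p {σ} uσ = w , uw , σ≡
  where
  j = lookup σ p
  j≢ : ∀ q → ¬ j ≡ lookup (removeAt σ p) q
  j≢ q e = Fin.punchInᵢ≢i p q (sym (VUnique.lookup-injective uσ p (punchIn p q)
             (trans e (lookup-removeAt σ p q))))
  w = tabulate (λ q → punchOut (j≢ q))
  uw : VUnique.Unique w
  uw = VUnique.tabulate⁺ λ {q} {r} e → Fin.punchIn-injective p q r
         (VUnique.lookup-injective uσ _ _ (begin
           lookup σ (punchIn p q)    ≡⟨ lookup-removeAt σ p q ⟨
           lookup (removeAt σ p) q   ≡⟨ Fin.punchOut-injective (j≢ q) (j≢ r) e ⟩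
           lookup (removeAt σ p) r   ≡⟨ lookup-removeAt σ p r ⟩
           lookup σ (punchIn p r)    ∎))
    where open ≡-Reasoning
  σ≡ : insertValueAt p j w ≡ σ
  σ≡ = begin
    insertAt (Vec.map (punchIn j) w) p j
      ≡⟨ cong (λ xs → insertAt xs p j) (Vec.tabulate-∘ (punchIn j) (λ q → punchOut (j≢ q))) ⟨
    insertAt (tabulate (λ q → punchIn j (punchOut (j≢ q)))) p j
      ≡⟨ cong (λ xs → insertAt xs p j) (Vec.tabulate-cong (λ q → Fin.punchIn-punchOut (j≢ q))) ⟩
    insertAt (tabulate (lookup (removeAt σ p))) p j
      ≡⟨ cong (λ xs → insertAt xs p j) (Vec.tabulate∘lookup (removeAt σ p)) ⟩
    insertAt (removeAt σ p) p j
      ≡⟨ Vec.insertAt-removeAt σ p ⟩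
    σ ∎
    where open ≡-Reasoning

Perms-fibre↭ : (p j : Fin (suc m)) →
               filter (λ σ → lookup σ p ≟ j) (Perms (suc m)) ↭ map (insertValueAt p j) (Perms m)
Perms-fibre↭ {m} p j = unique∧set⇒↭
  (LUnique.filter⁺ _ (Perms-unique (suc m)))
  (LUnique.map⁺ (insertValueAt-injective p j) (Perms-unique m))
  to from
  where
  to : ∀ {σ} → σ ∈ filter (λ σ → lookup σ p ≟ j) (Perms (suc m)) →
       σ ∈ map (insertValueAt p j) (Perms m)
  to σ∈ with ∈-filter⁻ _ {xs = Perms (suc m)} σ∈
  ... | σ∈Perms , refl with insertValueAt-surjective p (∈-Perms⁻ σ∈Perms)
  ...   | w , uw , w↦σ =
    subst (_∈ map (insertValueAt p j) (Perms m)) w↦σ (∈-map⁺ (insertValueAt p j) (∈-Perms⁺ uw))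
  from : ∀ {σ} → σ ∈ map (insertValueAt p j) (Perms m) →
         σ ∈ filter (λ σ → lookup σ p ≟ j) (Perms (suc m))
  from σ∈ with ∈-map⁻ (insertValueAt p j) σ∈
  ... | w , w∈Perms , refl = ∈-filter⁺ _
    (∈-Perms⁺ (insertValueAt-unique p j (∈-Perms⁻ w∈Perms)))
    (Vec.insertAt-lookup (Vec.map (punchIn j) w) p j)

length-Perms-fibre : (p j : Fin (suc m)) →
                     length (filter (λ σ → lookup σ p ≟ j) (Perms (suc m))) ≡ length (Perms m)
length-Perms-fibre {m} p j =
  trans (↭-length (Perms-fibre↭ p j)) (List.length-map (insertValueAt p j) (Perms m))

length-Perms-pairFibre : {p q j k : Fin (suc (suc m))} → ¬ p ≡ q → ¬ j ≡ k →
  length (filter (λ σ → lookup σ q ≟ k) (filter (λ σ → lookup σ p ≟ j) (Perms (suc (suc m)))))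
    ≡ length (Perms m)
length-Perms-pairFibre {m} {p} {q} {j} {k} p≢q j≢k = begin
  length (filter (λ σ → lookup σ q ≟ k) (filter (λ σ → lookup σ p ≟ j) (Perms (suc (suc m)))))
    ≡⟨ ↭-length (filter-↭ _ (Perms-fibre↭ p j)) ⟩
  length (filter (λ σ → lookup σ q ≟ k) (map (insertValueAt p j) (Perms (suc m))))
    ≡⟨ length-filter-map _ (insertValueAt p j) (Perms (suc m)) ⟩
  length (filter (λ w → lookup (insertValueAt p j w) q ≟ k) (Perms (suc m)))
    ≡⟨ cong length (List.filter-≐ _ _ ((λ {w} → to w) , (λ {w} → from w)) (Perms (suc m))) ⟩
  length (filter (λ w → lookup w q′ ≟ k′) (Perms (suc m)))
    ≡⟨ length-Perms-fibre q′ k′ ⟩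
  length (Perms m) ∎
  where
  open ≡-Reasoning
  q′ = punchOut p≢q
  k′ = punchOut j≢k
  lookup-q : ∀ w → lookup (insertValueAt p j w) q ≡ punchIn j (lookup w q′)
  lookup-q w = trans (cong (lookup (insertValueAt p j w)) (sym (Fin.punchIn-punchOut p≢q)))
                     (lookup-insertValueAt p j w q′)
  to : ∀ w → lookup (insertValueAt p j w) q ≡ k → lookup w q′ ≡ k′
  to w e = Fin.punchIn-injective j _ _
    (trans (sym (lookup-q w)) (trans e (sym (Fin.punchIn-punchOut j≢k))))
  from : ∀ w → lookup w q′ ≡ k′ → lookup (insertValueAt p j w) q ≡ k
  from w e = trans (lookup-q w) (trans (cong (punchIn j) e) (Fin.punchIn-punchOut j≢k))

map-allFin-suc : (h : Fin (suc n) → A) →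
                 map h (allFin (suc n)) ≡ h Fin.zero ∷ map (h ∘ Fin.suc) (allFin n)
map-allFin-suc {n} h = cong (h Fin.zero ∷_)
  (trans (List.map-tabulate Fin.suc h) (sym (List.map-tabulate (λ k → k) (h ∘ Fin.suc))))

module CommutativeMonoidSum {c ℓ : Level} (M : CommutativeMonoid c ℓ) where
  open CommutativeMonoid M renaming (refl to ≈-refl; sym to ≈-sym; trans to ≈-trans)
  open CommutativeSemigroupProperties commutativeSemigroup using (x∙yz≈y∙xz)
  open ≈-Reasoning setoid

  Σ : List Carrier → Carrier
  Σ = List.foldr _∙_ ε

  Σ-↭ : {xs ys : List Carrier} → xs ↭ ys → Σ xs ≈ Σ ys
  Σ-↭ xs↭ys =
    PermutationSetoid.foldr-commMonoid setoid isCommutativeMonoid (↭⇒↭ₛ′ isEquivalence xs↭ys)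

  Σ-++ : (xs ys : List Carrier) → Σ (xs List.++ ys) ≈ Σ xs ∙ Σ ys
  Σ-++ []       ys = ≈-sym (identityˡ (Σ ys))
  Σ-++ (x ∷ xs) ys = ≈-trans (∙-congˡ (Σ-++ xs ys)) (≈-sym (assoc x (Σ xs) (Σ ys)))

  Σ-map-cong : {f g : A → Carrier} → (∀ x → f x ≈ g x) → (xs : List A) → Σ (map f xs) ≈ Σ (map g xs)
  Σ-map-cong f≈g []       = ≈-refl
  Σ-map-cong f≈g (x ∷ xs) = ∙-cong (f≈g x) (Σ-map-cong f≈g xs)

  Σ-map-ε : (xs : List A) → Σ (map (λ _ → ε) xs) ≈ ε
  Σ-map-ε []       = ≈-refl
  Σ-map-ε (x ∷ xs) = ≈-trans (identityˡ _) (Σ-map-ε xs)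

  Σ-allFin-suc : (h : Fin (suc n) → Carrier) →
                 Σ (map h (allFin (suc n))) ≈ h Fin.zero ∙ Σ (map (h ∘ Fin.suc) (allFin n))
  Σ-allFin-suc h = reflexive (cong Σ (map-allFin-suc h))

  Σ-allFin-addAt : (y : Fin n) (z : Carrier) (G H : Fin n → Carrier) →
                   H y ≈ z ∙ G y → (∀ k → ¬ y ≡ k → H k ≈ G k) →
                   Σ (map H (allFin n)) ≈ z ∙ Σ (map G (allFin n))
  Σ-allFin-addAt {suc n} Fin.zero z G H at-y off-y = begin
    Σ (map H (allFin (suc n)))                           ≈⟨ Σ-allFin-suc H ⟩
    H Fin.zero ∙ Σ (map (H ∘ Fin.suc) (allFin n))
      ≈⟨ ∙-cong at-y (Σ-map-cong (λ k → off-y (Fin.suc k) λ ()) (allFin n)) ⟩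
    (z ∙ G Fin.zero) ∙ Σ (map (G ∘ Fin.suc) (allFin n))  ≈⟨ assoc z _ _ ⟩
    z ∙ (G Fin.zero ∙ Σ (map (G ∘ Fin.suc) (allFin n)))  ≈⟨ ∙-congˡ (Σ-allFin-suc G) ⟨
    z ∙ Σ (map G (allFin (suc n)))                       ∎
  Σ-allFin-addAt {suc n} (Fin.suc y) z G H at-y off-y = begin
    Σ (map H (allFin (suc n)))                           ≈⟨ Σ-allFin-suc H ⟩
    H Fin.zero ∙ Σ (map (H ∘ Fin.suc) (allFin n))
      ≈⟨ ∙-cong (off-y Fin.zero λ ())
                (Σ-allFin-addAt y z (G ∘ Fin.suc) (H ∘ Fin.suc) at-y
                   (λ k y≢k → off-y (Fin.suc k) (y≢k ∘ Fin.suc-injective))) ⟩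
    G Fin.zero ∙ (z ∙ Σ (map (G ∘ Fin.suc) (allFin n)))  ≈⟨ x∙yz≈y∙xz (G Fin.zero) z _ ⟩
    z ∙ (G Fin.zero ∙ Σ (map (G ∘ Fin.suc) (allFin n)))  ≈⟨ ∙-congˡ (Σ-allFin-suc G) ⟨
    z ∙ Σ (map G (allFin (suc n)))                       ∎

  Σ-partition : (φ : A → Fin n) (g : A → Carrier) (xs : List A) →
                Σ (map g xs) ≈ Σ (map (λ k → Σ (map g (filter (λ x → φ x ≟ k) xs))) (allFin n))
  Σ-partition {n = n} φ g []       = ≈-sym (Σ-map-ε (allFin n))
  Σ-partition φ g (x ∷ xs) = begin
    g x ∙ Σ (map g xs)                   ≈⟨ ∙-congˡ (Σ-partition φ g xs) ⟩
    g x ∙ Σ (map (fibre xs) (allFin _))  ≈⟨ Σ-allFin-addAt (φ x) (g x) (fibre xs) (fibre (x ∷ xs)) at off ⟨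
    Σ (map (fibre (x ∷ xs)) (allFin _))  ∎
    where
    fibre : List _ → Fin _ → Carrier
    fibre ys k = Σ (map g (filter (λ x → φ x ≟ k) ys))
    at : fibre (x ∷ xs) (φ x) ≈ g x ∙ fibre xs (φ x)
    at rewrite List.filter-accept (λ y → φ y ≟ φ x) {x} {xs} refl = ≈-refl
    off : ∀ k → ¬ φ x ≡ k → fibre (x ∷ xs) k ≈ fibre xs k
    off k φx≢k rewrite List.filter-reject (λ y → φ y ≟ k) {x} {xs} φx≢k = ≈-refl

sum-map-const : (c : ℕ) (xs : List A) → sum (map (λ _ → c) xs) ≡ length xs ℕ.* c
sum-map-const c []       = refl
sum-map-const c (x ∷ xs) = cong (c ℕ.+_) (sum-map-const c xs)

length-Perms : ∀ m → length (Perms m) ≡ m !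
length-Perms zero    = refl
length-Perms (suc m) = begin
  length (Perms (suc m))                              ≡⟨ count (Perms (suc m)) ⟨
  sum (map (λ _ → 1) (Perms (suc m)))
    ≡⟨ ℕSum.Σ-partition (λ σ → lookup σ Fin.zero) (λ _ → 1) (Perms (suc m)) ⟩
  sum (map (λ j → sum (map (λ _ → 1) (filter (λ σ → lookup σ Fin.zero ≟ j) (Perms (suc m)))))
           (allFin (suc m)))
    ≡⟨ cong sum (List.map-cong fibre (allFin (suc m))) ⟩
  sum (map (λ _ → m !) (allFin (suc m)))              ≡⟨ sum-map-const (m !) (allFin (suc m)) ⟩
  length (allFin (suc m)) ℕ.* m !
    ≡⟨ cong (ℕ._* m !) (List.length-tabulate {n = suc m} (λ k → k)) ⟩
  suc m ! ∎
  where
  open ≡-Reasoning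
  module ℕSum = CommutativeMonoidSum ℕ.+-0-commutativeMonoid
  count : ∀ (xs : List (Vec (Fin (suc m)) (suc m))) → sum (map (λ _ → 1) xs) ≡ length xs
  count xs = trans (sum-map-const 1 xs) (ℕ.*-identityʳ (length xs))
  fibre : ∀ j → sum (map (λ _ → 1) (filter (λ σ → lookup σ Fin.zero ≟ j) (Perms (suc m)))) ≡ m !
  fibre j = trans (count (filter (λ σ → lookup σ Fin.zero ≟ j) (Perms (suc m))))
                  (trans (length-Perms-fibre Fin.zero j) (length-Perms m))

-- Adjacent transpositions

-- For t + 1 ≥ m, swapAt t is the identity.
swapAt : ℕ → Vec A m → Vec A m
swapAt zero    []          = []
swapAt zero    (x ∷ [])    = x ∷ []
swapAt zero    (x ∷ y ∷ r) = y ∷ x ∷ r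
swapAt (suc t) []          = []
swapAt (suc t) (x ∷ r)     = x ∷ swapAt t r

swapAt-involutive : ∀ t (v : Vec A m) → swapAt t (swapAt t v) ≡ v
swapAt-involutive zero    []          = refl
swapAt-involutive zero    (x ∷ [])    = refl
swapAt-involutive zero    (x ∷ y ∷ r) = refl
swapAt-involutive (suc t) []          = refl
swapAt-involutive (suc t) (x ∷ r)     = cong (x ∷_) (swapAt-involutive t r)

All-swapAt : ∀ {p} {P : Pred A p} t {v : Vec A m} → VAll.All P v → VAll.All P (swapAt t v)
All-swapAt zero    {[]}        pv                            = pv
All-swapAt zero    {x ∷ []}    pv                            = pv
All-swapAt zero    {x ∷ y ∷ r} (px VAll.∷ py VAll.∷ pr) = py VAll.∷ px VAll.∷ pr
All-swapAt (suc t) {[]}        pv                            = pv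
All-swapAt (suc t) {x ∷ r}     (px VAll.∷ pr)              = px VAll.∷ All-swapAt t pr

Unique-swapAt : ∀ t {v : Vec A m} → VUnique.Unique v → VUnique.Unique (swapAt t v)
Unique-swapAt zero    {[]}        uv = uv
Unique-swapAt zero    {x ∷ []}    uv = uv
Unique-swapAt zero    {x ∷ y ∷ r} ((x≢y VAll.∷ x∉r) ∷ (y∉r ∷ ur)) =
  ((x≢y ∘ sym) VAll.∷ y∉r) ∷ (x∉r ∷ ur)
Unique-swapAt (suc t) {[]}        uv = uv
Unique-swapAt (suc t) {x ∷ r}     (x∉r ∷ ur) = All-swapAt t x∉r ∷ Unique-swapAt t ur

lookup-swapAt : (p q : Fin m) (v : Vec A m) → toℕ q ≡ suc (toℕ p) →
                lookup (swapAt (toℕ p) v) q ≡ lookup v p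
lookup-swapAt Fin.zero    (Fin.suc Fin.zero)    (x ∷ y ∷ r) _ = refl
lookup-swapAt Fin.zero    (Fin.suc (Fin.suc q)) v           ()
lookup-swapAt (Fin.suc p) (Fin.suc q)           (x ∷ r)     e = lookup-swapAt p q r (ℕ.suc-injective e)

toList-swapAt : ∀ t (v : Vec A m) → Vec.toList (swapAt t v) ↭ Vec.toList v
toList-swapAt zero    []          = ↭-refl
toList-swapAt zero    (x ∷ [])    = ↭-refl
toList-swapAt zero    (x ∷ y ∷ r) = ↭-swap y x ↭-refl
toList-swapAt (suc t) []          = ↭-refl
toList-swapAt (suc t) (x ∷ r)     = ↭-prep x (toList-swapAt t r)

map-swapAt-Perms↭ : ∀ t → map (swapAt t) (Perms n) ↭ Perms n
map-swapAt-Perms↭ {n} t =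
  unique∧set⇒↭ (LUnique.map⁺ swapAt-injective (Perms-unique n)) (Perms-unique n) to from
  where
  swapAt-injective : ∀ {v w : Vec (Fin n) n} → swapAt t v ≡ swapAt t w → v ≡ w
  swapAt-injective {v} {w} e =
    trans (sym (swapAt-involutive t v)) (trans (cong (swapAt t) e) (swapAt-involutive t w))
  to : ∀ {σ} → σ ∈ map (swapAt t) (Perms n) → σ ∈ Perms n
  to σ∈ with ∈-map⁻ (swapAt t) σ∈
  ... | τ , τ∈ , refl = ∈-Perms⁺ (Unique-swapAt t (∈-Perms⁻ τ∈))
  from : ∀ {σ} → σ ∈ Perms n → σ ∈ map (swapAt t) (Perms n)
  from {σ} σ∈ = subst (_∈ map (swapAt t) (Perms n)) (swapAt-involutive t σ)
    (∈-map⁺ (swapAt t) (∈-Perms⁺ (Unique-swapAt t (∈-Perms⁻ σ∈))))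

Perms-fibre-swapAt↭ : {p q : Fin n} → toℕ q ≡ suc (toℕ p) → (j : Fin n) →
  filter (λ σ → lookup σ q ≟ j) (Perms n)
    ↭ map (swapAt (toℕ p)) (filter (λ σ → lookup σ p ≟ j) (Perms n))
Perms-fibre-swapAt↭ {n} {p} {q} q≡p+1 j = begin
  filter (λ σ → lookup σ q ≟ j) (Perms n)
    ↭⟨ filter-↭ _ (map-swapAt-Perms↭ (toℕ p)) ⟨
  filter (λ σ → lookup σ q ≟ j) (map (swapAt (toℕ p)) (Perms n))
    ≡⟨ filter-map _ (swapAt (toℕ p)) (Perms n) ⟩
  map (swapAt (toℕ p)) (filter (λ σ → lookup (swapAt (toℕ p) σ) q ≟ j) (Perms n))
    ≡⟨ cong (map (swapAt (toℕ p)))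
            (List.filter-≐ _ _ ((λ {σ} → trans (sym (lookup-q σ))) , (λ {σ} → trans (lookup-q σ))) (Perms n)) ⟩
  map (swapAt (toℕ p)) (filter (λ σ → lookup σ p ≟ j) (Perms n)) ∎
  where
  open PermutationReasoning
  lookup-q : ∀ σ → lookup (swapAt (toℕ p) σ) q ≡ lookup σ p
  lookup-q σ = lookup-swapAt p q σ q≡p+1

-- Sums over ordered pairs

toList≡tabulate-lookup : (v : Vec A n) → Vec.toList v ≡ List.tabulate (lookup v)
toList≡tabulate-lookup []      = refl
toList≡tabulate-lookup (x ∷ v) = cong (x ∷_) (toList≡tabulate-lookup v)

orderedPairs : (A → A → B) → Vec A m → List B
orderedPairs {m = m} a σ = List.concatMap
  (λ p → map (λ q → a (lookup σ p) (lookup σ q)) (filter (p Fin.<?_) (allFin m))) (allFin m)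

orderedPairs-∷ : (a : A → A → B) (x : A) (σ : Vec A m) →
                 orderedPairs a (x ∷ σ) ≡ map (a x) (Vec.toList σ) List.++ orderedPairs a σ
orderedPairs-∷ {B = B} {m = m} a x σ = cong₂ List._++_ first-row (cong List.concat later-rows)
  where
  open ≡-Reasoning
  row : Fin (suc m) → List B
  row p = map (λ q → a (lookup (x ∷ σ) p) (lookup (x ∷ σ) q)) (filter (p Fin.<?_) (allFin (suc m)))
  row′ : Fin m → List B
  row′ p = map (λ q → a (lookup σ p) (lookup σ q)) (filter (p Fin.<?_) (allFin m))
  first-row : row Fin.zero ≡ map (a x) (Vec.toList σ)
  first-row = begin
    map (a x ∘ lookup (x ∷ σ)) (filter (Fin.zero {n = m} Fin.<?_) (List.tabulate {n = m} Fin.suc))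
      ≡⟨ cong (map (a x ∘ lookup (x ∷ σ)))
              (List.filter-all (Fin.zero {n = m} Fin.<?_) (LAll.tabulate⁺ (λ _ → s≤s z≤n))) ⟩
    map (a x ∘ lookup (x ∷ σ)) (List.tabulate Fin.suc)
      ≡⟨ List.map-tabulate Fin.suc (a x ∘ lookup (x ∷ σ)) ⟩
    List.tabulate (a x ∘ lookup σ)        ≡⟨ List.map-tabulate (lookup σ) (a x) ⟨
    map (a x) (List.tabulate (lookup σ))  ≡⟨ cong (map (a x)) (toList≡tabulate-lookup σ) ⟨
    map (a x) (Vec.toList σ)              ∎
  row-suc : ∀ p → row (Fin.suc p) ≡ row′ p
  row-suc p = begin
    map g (filter (Fin.suc p Fin.<?_) (List.tabulate Fin.suc))
      ≡⟨ cong (map g ∘ filter (Fin.suc p Fin.<?_)) (List.map-tabulate (λ q → q) Fin.suc) ⟨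
    map g (filter (Fin.suc p Fin.<?_) (map Fin.suc (allFin m)))
      ≡⟨ cong (map g) (filter-map (Fin.suc p Fin.<?_) Fin.suc (allFin m)) ⟩
    map g (map Fin.suc (filter (λ q → Fin.suc p Fin.<? Fin.suc q) (allFin m)))
      ≡⟨ List.map-∘ (filter (λ q → Fin.suc p Fin.<? Fin.suc q) (allFin m)) ⟨
    map (g ∘ Fin.suc) (filter (λ q → Fin.suc p Fin.<? Fin.suc q) (allFin m))
      ≡⟨ cong (map (g ∘ Fin.suc)) (List.filter-≐ _ _ (ℕ.s≤s⁻¹ , s≤s) (allFin m)) ⟩
    row′ p ∎
    where
    g : Fin (suc m) → B
    g q = a (lookup σ p) (lookup (x ∷ σ) q)
  later-rows : map row (List.tabulate Fin.suc) ≡ map row′ (allFin m)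
  later-rows = trans (List.map-tabulate Fin.suc row)
                     (trans (List.tabulate-cong row-suc) (sym (List.map-tabulate (λ q → q) row′)))

module _ {c ℓ : Level} (R : CommutativeRing c ℓ) where
  open CommutativeRing R renaming (refl to ≈-refl; sym to ≈-sym; trans to ≈-trans)
  open WithRing R
  open CommutativeMonoidSum +-commutativeMonoid using (Σ-↭; Σ-++; Σ-map-cong; Σ-partition)
  open CommutativeSemigroupProperties +-commutativeSemigroup using (interchange; xy∙z≈zy∙x)
  open AbelianGroupProperties +-abelianGroup using (⁻¹-∙-comm)
  open SemiringMult semiring using (×1-homo-*) renaming (_×_ to _×ᵣ_)
  open ≈-Reasoning setoid

  fromℕ≡×1# : ∀ m → fromℕ m ≡ m ×ᵣ 1#
  fromℕ≡×1# zero    = refl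
  fromℕ≡×1# (suc m) = cong (1# +_) (fromℕ≡×1# m)

  fromℕ-* : ∀ m n → fromℕ (m ℕ.* n) ≈ fromℕ m * fromℕ n
  fromℕ-* m n rewrite fromℕ≡×1# m | fromℕ≡×1# n | fromℕ≡×1# (m ℕ.* n) = ×1-homo-* m n

  x+a≈y+b⇒x-y≈b-a : ∀ {x y α β} → x + α ≈ y + β → x - y ≈ β - α
  x+a≈y+b⇒x-y≈b-a {x} {y} {α} {β} x+α≈y+β = begin
    x - y                        ≈⟨ +-identityʳ (x - y) ⟨
    (x - y) + 0#                 ≈⟨ +-congˡ (-‿inverseʳ α) ⟨
    (x - y) + (α - α)            ≈⟨ interchange x (- y) α (- α) ⟩
    (x + α) + (- y - α)          ≈⟨ +-congʳ x+α≈y+β ⟩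
    (y + β) + (- y - α)          ≈⟨ interchange y β (- y) (- α) ⟩
    (y - y) + (β - α)            ≈⟨ +-congʳ (-‿inverseʳ y) ⟩
    0# + (β - α)                 ≈⟨ +-identityˡ (β - α) ⟩
    β - α                        ∎

  Σ-map-const : (z : Carrier) (xs : List A) → sumL (map (λ _ → z) xs) ≈ fromℕ (length xs) * z
  Σ-map-const z []       = ≈-sym (zeroˡ z)
  Σ-map-const z (x ∷ xs) = begin
    z + sumL (map (λ _ → z) xs)     ≈⟨ +-cong (≈-sym (*-identityˡ z)) (Σ-map-const z xs) ⟩
    1# * z + fromℕ (length xs) * z  ≈⟨ distribʳ z 1# (fromℕ (length xs)) ⟨
    (1# + fromℕ (length xs)) * z    ∎

  Σ-map-*ˡ : (x : Carrier) (g : A → Carrier) (xs : List A) →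
             sumL (map (λ y → x * g y) xs) ≈ x * sumL (map g xs)
  Σ-map-*ˡ x g []       = ≈-sym (zeroʳ x)
  Σ-map-*ˡ x g (y ∷ ys) = ≈-trans (+-congˡ (Σ-map-*ˡ x g ys)) (≈-sym (distribˡ x (g y) _))

  Σ-map-− : (g h : A → Carrier) (xs : List A) →
            sumL (map g xs) - sumL (map h xs) ≈ sumL (map (λ x → g x - h x) xs)
  Σ-map-− g h []       = -‿inverseʳ 0#
  Σ-map-− g h (x ∷ xs) = begin
    (g x + sumL (map g xs)) - (h x + sumL (map h xs))
      ≈⟨ +-congˡ (⁻¹-∙-comm (h x) (sumL (map h xs))) ⟨
    (g x + sumL (map g xs)) + (- h x - sumL (map h xs))
      ≈⟨ interchange (g x) _ (- h x) _ ⟩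
    (g x - h x) + (sumL (map g xs) - sumL (map h xs))
      ≈⟨ +-congˡ (Σ-map-− g h xs) ⟩
    (g x - h x) + sumL (map (λ x → g x - h x) xs) ∎

  Σ-map-filter-cong : ∀ {p} {P : Pred A p} (P? : Decidable P) {g g′ : A → Carrier} →
                      (∀ x → P x → g x ≈ g′ x) → (xs : List A) →
                      sumL (map g (filter P? xs)) ≈ sumL (map g′ (filter P? xs))
  Σ-map-filter-cong P? g≈g′ []       = ≈-refl
  Σ-map-filter-cong P? g≈g′ (x ∷ xs) with P? x
  ... | yes px = +-cong (g≈g′ x px) (Σ-map-filter-cong P? g≈g′ xs)
  ... | no  _  = Σ-map-filter-cong P? g≈g′ xs

  Σ-map-filter : ∀ {p} {P : Pred A p} (P? : Decidable P) {g : A → Carrier} →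
                 (∀ x → ¬ P x → g x ≈ 0#) → (xs : List A) →
                 sumL (map g xs) ≈ sumL (map g (filter P? xs))
  Σ-map-filter P? g≈0 []       = ≈-refl
  Σ-map-filter P? g≈0 (x ∷ xs) with P? x
  ... | yes _   = +-congˡ (Σ-map-filter P? g≈0 xs)
  ... | no  ¬px = ≈-trans (+-congʳ (g≈0 x ¬px)) (≈-trans (+-identityˡ _) (Σ-map-filter P? g≈0 xs))

  Σ-map-∘-byFibres : (φ : A → Fin n) (g : Fin n → Carrier) (xs : List A) →
    sumL (map (g ∘ φ) xs) ≈ sumL (map (λ k → fromℕ (length (filter (λ x → φ x ≟ k) xs)) * g k) (allFin n))
  Σ-map-∘-byFibres {n = n} φ g xs = begin
    sumL (map (g ∘ φ) xs)
      ≈⟨ Σ-partition φ (g ∘ φ) xs ⟩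
    sumL (map (λ k → sumL (map (g ∘ φ) (filter (λ x → φ x ≟ k) xs))) (allFin n))
      ≈⟨ Σ-map-cong fibre (allFin n) ⟩
    sumL (map (λ k → fromℕ (length (filter (λ x → φ x ≟ k) xs)) * g k) (allFin n)) ∎
    where
    fibre : ∀ k → sumL (map (g ∘ φ) (filter (λ x → φ x ≟ k) xs))
                  ≈ fromℕ (length (filter (λ x → φ x ≟ k) xs)) * g k
    fibre k = ≈-trans (Σ-map-filter-cong (λ x → φ x ≟ k) (λ x φx≡k → reflexive (cong g φx≡k)) xs)
                      (Σ-map-const (g k) (filter (λ x → φ x ≟ k) xs))

  pairSum : (A → A → Carrier) → Vec A m → Carrier
  pairSum a []      = 0#
  pairSum a (x ∷ σ) = sumL (map (a x) (Vec.toList σ)) + pairSum a σ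

  Σ-orderedPairs : (a : A → A → Carrier) (σ : Vec A m) → sumL (orderedPairs a σ) ≈ pairSum a σ
  Σ-orderedPairs a []      = ≈-refl
  Σ-orderedPairs a (x ∷ σ) = begin
    sumL (orderedPairs a (x ∷ σ))
      ≡⟨ cong sumL (orderedPairs-∷ a x σ) ⟩
    sumL (map (a x) (Vec.toList σ) List.++ orderedPairs a σ)
      ≈⟨ Σ-++ (map (a x) (Vec.toList σ)) (orderedPairs a σ) ⟩
    sumL (map (a x) (Vec.toList σ)) + sumL (orderedPairs a σ)
      ≈⟨ +-congˡ (Σ-orderedPairs a σ) ⟩
    pairSum a (x ∷ σ) ∎

  pairSum-swapAt : (a : A → A → Carrier) (p q : Fin m) (v : Vec A m) → toℕ q ≡ suc (toℕ p) →
    pairSum a (swapAt (toℕ p) v) + a (lookup v p) (lookup v q) ≈ pairSum a v + a (lookup v q) (lookup v p)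
  pairSum-swapAt a Fin.zero (Fin.suc Fin.zero) (x ∷ y ∷ r) _ = begin
    ((a y x + Y) + (X + Z)) + a x y   ≈⟨ +-congʳ (interchange (a y x) Y X Z) ⟩
    ((a y x + X) + (Y + Z)) + a x y   ≈⟨ +-congʳ (+-assoc (a y x) X (Y + Z)) ⟩
    (a y x + (X + (Y + Z))) + a x y   ≈⟨ xy∙z≈zy∙x (a y x) (X + (Y + Z)) (a x y) ⟩
    (a x y + (X + (Y + Z))) + a y x   ≈⟨ +-congʳ (+-assoc (a x y) X (Y + Z)) ⟨
    ((a x y + X) + (Y + Z)) + a y x   ∎
    where
    X = sumL (map (a x) (Vec.toList r))
    Y = sumL (map (a y) (Vec.toList r))
    Z = pairSum a r
  pairSum-swapAt a Fin.zero    (Fin.suc (Fin.suc q)) v ()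
  pairSum-swapAt a (Fin.suc p) (Fin.suc q) (x ∷ r) q≡p+1 = begin
    (sumL (map (a x) (Vec.toList (swapAt (toℕ p) r))) + pairSum a (swapAt (toℕ p) r)) + α
      ≈⟨ +-congʳ (+-congʳ (Σ-↭ (↭-map⁺ (a x) (toList-swapAt (toℕ p) r)))) ⟩
    (X + pairSum a (swapAt (toℕ p) r)) + α  ≈⟨ +-assoc X _ α ⟩
    X + (pairSum a (swapAt (toℕ p) r) + α)  ≈⟨ +-congˡ (pairSum-swapAt a p q r (ℕ.suc-injective q≡p+1)) ⟩
    X + (pairSum a r + β)                   ≈⟨ +-assoc X (pairSum a r) β ⟨
    (X + pairSum a r) + β                   ∎
    where
    X = sumL (map (a x) (Vec.toList r))
    α = a (lookup r p) (lookup r q)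
    β = a (lookup r q) (lookup r p)

  f-swapAt : (a : Fin n → Fin n → Carrier) (p q : Fin n) (σ : Vec (Fin n) n) → toℕ q ≡ suc (toℕ p) →
             f a (swapAt (toℕ p) σ) - f a σ ≈ a (lookup σ q) (lookup σ p) - a (lookup σ p) (lookup σ q)
  f-swapAt a p q σ q≡p+1 = x+a≈y+b⇒x-y≈b-a (begin
    f a (swapAt (toℕ p) σ) + a (lookup σ p) (lookup σ q)
      ≈⟨ +-congʳ (Σ-orderedPairs a (swapAt (toℕ p) σ)) ⟩
    pairSum a (swapAt (toℕ p) σ) + a (lookup σ p) (lookup σ q)
      ≈⟨ pairSum-swapAt a p q σ q≡p+1 ⟩
    pairSum a σ + a (lookup σ q) (lookup σ p)
      ≈⟨ +-congʳ (Σ-orderedPairs a σ) ⟨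
    f a σ + a (lookup σ q) (lookup σ p) ∎)

  skew : (Fin n → Fin n → Carrier) → Fin n → Fin n → Carrier
  skew a j k = a k j - a j k

  S-adjacent-difference : (a : Fin n → Fin n → Carrier) {p q : Fin n} →
    toℕ q ≡ suc (toℕ p) → (j : Fin n) →
    S a q j - S a p j
      ≈ sumL (map (skew a j ∘ (λ σ → lookup σ q)) (filter (λ σ → lookup σ p ≟ j) (Perms n)))
  S-adjacent-difference {n} a {p} {q} q≡p+1 j = begin
    S a q j - S a p j
      ≈⟨ +-congʳ (Σ-↭ (↭-map⁺ (f a) (Perms-fibre-swapAt↭ q≡p+1 j))) ⟩
    sumL (map (f a) (map swap L)) - sumL (map (f a) L)
      ≡⟨ cong (λ xs → sumL xs - sumL (map (f a) L)) (List.map-∘ L) ⟨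
    sumL (map (f a ∘ swap) L) - sumL (map (f a) L)
      ≈⟨ Σ-map-− (f a ∘ swap) (f a) L ⟩
    sumL (map (λ σ → f a (swap σ) - f a σ) L)
      ≈⟨ Σ-map-filter-cong (λ σ → lookup σ p ≟ j) swap-difference (Perms n) ⟩
    sumL (map (skew a j ∘ (λ σ → lookup σ q)) L) ∎
    where
    swap : Vec (Fin n) n → Vec (Fin n) n
    swap = swapAt (toℕ p)
    L = filter (λ σ → lookup σ p ≟ j) (Perms n)
    swap-difference : ∀ σ → lookup σ p ≡ j → f a (swap σ) - f a σ ≈ skew a j (lookup σ q)
    swap-difference σ σp≡j = subst (λ y → f a (swap σ) - f a σ ≈ a (lookup σ q) y - a y (lookup σ q))
                                   σp≡j (f-swapAt a p q σ q≡p+1)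

  Σ-fibre-skew : (a : Fin (suc (suc m)) → Fin (suc (suc m)) → Carrier) {p q : Fin (suc (suc m))} →
    ¬ p ≡ q → (j : Fin (suc (suc m))) →
    sumL (map (skew a j ∘ (λ σ → lookup σ q)) (filter (λ σ → lookup σ p ≟ j) (Perms (suc (suc m)))))
      ≈ fromℕ (m !) * D a j
  Σ-fibre-skew {m} a {p} {q} p≢q j = begin
    sumL (map (skew a j ∘ (λ σ → lookup σ q)) L)
      ≈⟨ Σ-map-∘-byFibres (λ σ → lookup σ q) (skew a j) L ⟩
    sumL (map (λ k → fromℕ (count k) * skew a j k) (allFin _))
      ≈⟨ Σ-map-filter (λ k → ¬? (k ≟ j)) diagonal-term (allFin _) ⟩
    sumL (map (λ k → fromℕ (count k) * skew a j k) (filter (λ k → ¬? (k ≟ j)) (allFin _)))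
      ≈⟨ Σ-map-filter-cong (λ k → ¬? (k ≟ j))
           (λ k k≢j → *-congʳ (reflexive (cong fromℕ (count-off-diagonal k k≢j)))) (allFin _) ⟩
    sumL (map (λ k → fromℕ (m !) * skew a j k) (filter (λ k → ¬? (k ≟ j)) (allFin _)))
      ≈⟨ Σ-map-*ˡ (fromℕ (m !)) (skew a j) (filter (λ k → ¬? (k ≟ j)) (allFin _)) ⟩
    fromℕ (m !) * D a j ∎
    where
    L = filter (λ σ → lookup σ p ≟ j) (Perms (suc (suc m)))
    count : Fin (suc (suc m)) → ℕ
    count k = length (filter (λ σ → lookup σ q ≟ k) L)
    diagonal-term : ∀ k → ¬ ¬ k ≡ j → fromℕ (count k) * skew a j k ≈ 0#
    diagonal-term k ¬k≢j with refl ← decidable-stable (k ≟ j) ¬k≢j =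
      ≈-trans (*-congˡ (-‿inverseʳ (a j j))) (zeroʳ _)
    count-off-diagonal : ∀ k → ¬ k ≡ j → count k ≡ m !
    count-off-diagonal k k≢j = trans (length-Perms-pairFibre p≢q (k≢j ∘ sym)) (length-Perms m)

proposition9 : {c ℓ : Level} (R : CommutativeRing c ℓ) (n : ℕ) → 2 ≤ n →
    (a : Fin n → Fin n → CommutativeRing.Carrier R) →
    (∀ k → CommutativeRing._≈_ R (a k k) (CommutativeRing.0# R)) →
    (i : Fin n) (hi : suc (toℕ i) < n) (j : Fin n) →
    CommutativeRing._≈_ R
      (CommutativeRing._*_ R (WithRing.fromℕ R (n ∸ 1))
        (CommutativeRing._-_ R (WithRing.S R a (fromℕ< hi) j) (WithRing.S R a i j)))
      (CommutativeRing._*_ R (WithRing.fromℕ R ((n ∸ 1) !)) (WithRing.D R a j))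
proposition9 R (suc (suc m)) (s≤s (s≤s z≤n)) a _ i hi j = begin
  fromℕ (suc m) * (S a i₁ j - S a i j)
    ≈⟨ *-congˡ (S-adjacent-difference R a i₁≡i+1 j) ⟩
  fromℕ (suc m) * sumL (map (skew R a j ∘ (λ σ → lookup σ i₁))
                             (filter (λ σ → lookup σ i ≟ j) (Perms (suc (suc m)))))
    ≈⟨ *-congˡ (Σ-fibre-skew R a i≢i₁ j) ⟩
  fromℕ (suc m) * (fromℕ (m !) * D a j)         ≈⟨ *-assoc _ _ _ ⟨
  (fromℕ (suc m) * fromℕ (m !)) * D a j         ≈⟨ *-congʳ (fromℕ-* R (suc m) (m !)) ⟨
  fromℕ (suc m !) * D a j                       ∎
  where
  open CommutativeRing R using (_*_; _-_; *-congˡ; *-congʳ; *-assoc; setoid)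
  open WithRing R
  open ≈-Reasoning setoid
  i₁ = fromℕ< hi
  i₁≡i+1 : toℕ i₁ ≡ suc (toℕ i)
  i₁≡i+1 = Fin.toℕ-fromℕ< hi
  i≢i₁ : ¬ i ≡ i₁
  i≢i₁ i≡i₁ = ℕ.1+n≢n (trans (sym i₁≡i+1) (sym (cong toℕ i≡i₁)))
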